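{- Let $\mathcal{Q}$ be a finite thick generalised quadrangle of order $(s,t)$ and let $G$ be a group of automorphisms of $\mathcal{Q}$ acting transitively on the points. If $\alpha$ is a point of $\mathcal{Q}$, then $|G|/|G_\alpha|<(1+t)^5$. If moreover $G$ acts transitively on flags, then $|G|<|G_\alpha|^6$.
   Context: A finite generalised quadrangle is a finite point-line geometry in which every two points lie on at most one line and, for every point $p$ and line $L$ not through $p$, there is a unique point on $L$ collinear with $p$; thick of order $(s,t)$ means every line has $s+1\ge3$ points and every point lies on $t+1\ge3$ lines. A flag is an incident point-line pair; $G_\alpha$ is the stabiliser of $\alpha$. -}

module Defs where

open import Data.Nat using (ℕ; suc; _≤_)
open import Data.Fin using (Fin; _≟_)
open import Data.Bool using (Bool; true)
open import Data.List using (List; length; filterᵇ; allFin)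
open import Data.Product using (Σ; ∃; ∃-syntax; _×_)
open import Relation.Binary.PropositionalEquality using (_≡_; _≢_)
open import Relation.Nullary.Decidable using (⌊_⌋)
open import Algebra.Structures using (IsGroup)

#[_] : ∀ {n} → (Fin n → Bool) → ℕ
#[_] {n} f = length (filterᵇ f (allFin n))

record Geometry : Set where
  field
    np nl : ℕ
    I     : Fin np → Fin nl → Bool

  Collinear : Fin np → Fin np → Set
  Collinear x y = ∃[ M ] (I x M ≡ true × I y M ≡ true)

record IsThickGQ (Q : Geometry) (s t : ℕ) : Set where
  open Geometry Q
  field
    atMostOneLine : ∀ (x y : Fin np) (L M : Fin nl) → x ≢ y →
      I x L ≡ true → I y L ≡ true → I x M ≡ true → I y M ≡ true → L ≡ M
    gqAxiomExists : ∀ (p : Fin np) (L : Fin nl) → I p L ≢ true →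
      ∃[ x ] (I x L ≡ true × Collinear p x)
    gqAxiomUnique : ∀ (p : Fin np) (L : Fin nl) → I p L ≢ true →
      ∀ (x y : Fin np) → I x L ≡ true → Collinear p x →
      I y L ≡ true → Collinear p y → x ≡ y
    linePoints : ∀ (L : Fin nl) → #[ (λ x → I x L) ] ≡ suc s
    pointLines : ∀ (x : Fin np) → #[ (λ L → I x L) ] ≡ suc t
    s≥2 : 2 ≤ s
    t≥2 : 2 ≤ t

-- A finite group G of order n (carrier Fin n) acting faithfully on Q by
-- automorphisms, i.e. G is (isomorphic to) a group of automorphisms of Q.
record AutGroup (Q : Geometry) : Set where
  open Geometry Q
  field
    n       : ℕ
    _∙_     : Fin n → Fin n → Fin n
    ε       : Fin n
    _⁻¹     : Fin n → Fin n
    isGroup : IsGroup _≡_ _∙_ ε _⁻¹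
    actP    : Fin n → Fin np → Fin np
    actL    : Fin n → Fin nl → Fin nl
    actP-ε  : ∀ x → actP ε x ≡ x
    actL-ε  : ∀ L → actL ε L ≡ L
    actP-∙  : ∀ g h x → actP (g ∙ h) x ≡ actP g (actP h x)
    actL-∙  : ∀ g h L → actL (g ∙ h) L ≡ actL g (actL h L)
    preservesI : ∀ g x L → I (actP g x) (actL g L) ≡ I x L
    faithful : ∀ g → (∀ x → actP g x ≡ x) → (∀ L → actL g L ≡ L) → g ≡ ε

  order : ℕ
  order = n

  stabOrder : Fin np → ℕ
  stabOrder α = #[ (λ g → ⌊ actP g α ≟ α ⌋) ]

  PointTransitive : Set
  PointTransitive = ∀ (x y : Fin np) → ∃[ g ] (actP g x ≡ y)

  FlagTransitive : Set
  FlagTransitive = ∀ (x y : Fin np) (L M : Fin nl) →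
    I x L ≡ true → I y M ≡ true → ∃[ g ] (actP g x ≡ y × actL g L ≡ M)

module Submission where

-- By orbit–stabiliser, |G : G_α| is the number of points, and every point lies on
-- one of the t + 1 lines through some point of a fixed line, so there are at most
-- (s + 1)²(t + 1) points.  Higman's inequality s ≤ t² makes this less than (1 + t)⁵.
-- It is proved (as t ≤ s² for the dual quadrangle) by Cauchy–Schwarz: for
-- non-collinear x, y let t_z = |{x, y, z}^⊥| for the points z collinear with neither;
-- counting gives ∑ t_z, a bound for ∑ t_z² and the number of such z, and the
-- inequality (∑ t_z)² ≤ (number of z) · ∑ t_z² reduces to (s − 1) t (s² − t) ≥ 0.
-- If G is flag-transitive, G_α is transitive on the t + 1 lines through α, so
-- |G_α| ≥ t + 1 and |G| < |G_α|⁵ · |G_α|.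

open import Defs
open import Data.Nat using (ℕ; zero; suc; pred; >-nonZero; _+_; _*_; _∸_; _^_; _≤_; _<_; z≤n; s≤s)
open import Data.Nat.Properties hiding (suc-injective; _≟_)
open import Data.Nat.Tactic.RingSolver using (solve-∀)
open import Data.Fin using (Fin; zero; suc; _≟_)
open import Data.Fin.Properties using (suc-injective; any?)
open import Data.Bool using (Bool; true; false) renaming (_≟_ to _≟ᵇ_)
open import Data.List using (filterᵇ; tabulate; length)
open import Data.Product using (∃-syntax; _×_; _,_; proj₁; proj₂)
open import Data.Sum using (inj₁; inj₂)
open import Function using (_∘_; id)
open import Algebra.Structures using (IsGroup)
open import Algebra.Properties.CommutativeSemigroup *-commutativeSemigroup using (x∙yz≈y∙xz; xy∙z≈xz∙y)
open import Relation.Nullary using (¬_; Dec; yes; no; ¬?; contradiction)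
open import Relation.Nullary.Decidable using (⌊_⌋; _×-dec_)
open import Relation.Binary.PropositionalEquality
  using (_≡_; _≢_; refl; sym; trans; cong; cong₂; subst; subst₂; module ≡-Reasoning)
open import Algebra.Properties.Semiring.Sum +-*-semiring
  using (sum; sum-syntax; sum-cong-≗; ∑-distrib-+; ∑-comm; *-distribˡ-sum; *-distribʳ-sum)

-- Finite sums of natural numbers

∑-mono-≤ : ∀ {n} {f g : Fin n → ℕ} → (∀ i → f i ≤ g i) → sum f ≤ sum g
∑-mono-≤ {zero}  f≤g = z≤n
∑-mono-≤ {suc n} f≤g = +-mono-≤ (f≤g zero) (∑-mono-≤ (f≤g ∘ suc))

∑-const : ∀ n c → ∑[ i < n ] c ≡ n * c
∑-const zero    c = refl
∑-const (suc n) c = cong (c +_) (∑-const n c)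

term≤∑ : ∀ {n} (f : Fin n → ℕ) i → f i ≤ sum f
term≤∑ f zero    = m≤m+n _ _
term≤∑ f (suc i) = ≤-trans (term≤∑ (f ∘ suc) i) (m≤n+m _ _)

∑-pos⇒∃-pos : ∀ {n} (f : Fin n → ℕ) → 0 < sum f → ∃[ i ] 0 < f i
∑-pos⇒∃-pos {suc n} f ∑f>0 with f zero in eq
... | suc _ = zero , subst (0 <_) (sym eq) (s≤s z≤n)
... | zero  with ∑-pos⇒∃-pos (f ∘ suc) ∑f>0
... | i , fi>0 = suc i , fi>0

∑-zero : ∀ {n} (f : Fin n → ℕ) → (∀ i → f i ≡ 0) → sum f ≡ 0
∑-zero {n} f f≡0 = trans (sum-cong-≗ f≡0) (trans (∑-const n 0) (*-zeroʳ n))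

∑-single : ∀ {n} (f : Fin n → ℕ) a → (∀ i → i ≢ a → f i ≡ 0) → sum f ≡ f a
∑-single f zero f≡0 =
  trans (cong (f zero +_) (∑-zero (f ∘ suc) (λ i → f≡0 (suc i) λ ()))) (+-identityʳ _)
∑-single f (suc a) f≡0 =
  trans (cong (_+ sum (f ∘ suc)) (f≡0 zero λ ()))
        (∑-single (f ∘ suc) a (λ i i≢a → f≡0 (suc i) (i≢a ∘ suc-injective)))

∑-≤1 : ∀ {n} (f : Fin n → ℕ) → (∀ i → f i ≤ 1) →
  (∀ i j → 0 < f i → 0 < f j → i ≡ j) → sum f ≤ 1
∑-≤1 {zero}  f f≤1 unique = z≤n
∑-≤1 {suc n} f f≤1 unique with f zero in eq
... | zero  = ∑-≤1 (f ∘ suc) (f≤1 ∘ suc)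
                (λ i j fi>0 fj>0 → suc-injective (unique (suc i) (suc j) fi>0 fj>0))
... | suc k = subst (λ m → m + sum (f ∘ suc) ≤ 1) eq
                (≤-trans (≤-reflexive (trans (cong (f zero +_) rest≡0) (+-identityʳ _))) (f≤1 zero))
  where
  rest≡0 : sum (f ∘ suc) ≡ 0
  rest≡0 = ∑-zero (f ∘ suc) λ i → n≤0⇒n≡0 (≮⇒≥ λ fi>0 →
    contradiction (unique zero (suc i) (subst (0 <_) (sym eq) (s≤s z≤n)) fi>0) λ ())

*-pos : ∀ {m n} → 0 < m → 0 < n → 0 < m * n
*-pos = *-mono-≤

*-pos⁻ : ∀ m {n} → 0 < m * n → 0 < m × 0 < n
*-pos⁻ (suc m) {suc n} _ = s≤s z≤n , s≤s z≤n
*-pos⁻ (suc m) {zero} mn>0 = contradiction (subst (0 <_) (*-zeroʳ m) mn>0) λ ()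

*-pos⁻₃ : ∀ m n {o} → 0 < m * n * o → 0 < m × 0 < n × 0 < o
*-pos⁻₃ m n mno>0 with *-pos⁻ (m * n) mno>0
... | mn>0 , o>0 = proj₁ (*-pos⁻ m mn>0) , proj₂ (*-pos⁻ m mn>0) , o>0

∑-cover : ∀ {a b} (P : Fin a → ℕ) (Q : Fin b → ℕ) (R : Fin b → Fin a → ℕ) →
  (∀ i → P i ≤ 1) → (∀ i → 0 < P i → ∃[ j ] (0 < Q j × 0 < R j i)) →
  sum P ≤ ∑[ j < b ] (Q j * ∑[ i < a ] R j i)
∑-cover {a} {b} P Q R P≤1 covered = begin
  sum P                                    ≤⟨ ∑-mono-≤ P≤∑QR ⟩
  ∑[ i < a ] ∑[ j < b ] (Q j * R j i)      ≡⟨ ∑-comm (λ i j → Q j * R j i) ⟩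
  ∑[ j < b ] ∑[ i < a ] (Q j * R j i)      ≡⟨ sum-cong-≗ (λ j → sym (*-distribˡ-sum (Q j) (R j))) ⟩
  ∑[ j < b ] (Q j * ∑[ i < a ] R j i)      ∎
  where
  open ≤-Reasoning
  P≤∑QR : ∀ i → P i ≤ ∑[ j < b ] (Q j * R j i)
  P≤∑QR i with P i in eq
  ... | zero  = z≤n
  ... | suc _ with covered i (subst (0 <_) (sym eq) (s≤s z≤n))
  ... | j , Qj>0 , Rji>0 = ≤-trans (subst (_≤ 1) eq (P≤1 i))
                             (≤-trans (*-pos Qj>0 Rji>0) (term≤∑ (λ j → Q j * R j i) j))

∑-*-≤ : ∀ {n} (P f : Fin n → ℕ) c → (∀ i → 0 < P i → f i ≤ c) →
  ∑[ i < n ] (P i * f i) ≤ sum P * c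
∑-*-≤ P f c f≤c = ≤-trans (∑-mono-≤ Pf≤Pc) (≤-reflexive (sym (*-distribʳ-sum c P)))
  where
  Pf≤Pc : ∀ i → P i * f i ≤ P i * c
  Pf≤Pc i with P i in eq
  ... | zero  = z≤n
  ... | suc k = *-monoʳ-≤ (suc k) (f≤c i (subst (0 <_) (sym eq) (s≤s z≤n)))

∑-*-≥ : ∀ {n} (P f : Fin n → ℕ) c → (∀ i → 0 < P i → c ≤ f i) →
  sum P * c ≤ ∑[ i < n ] (P i * f i)
∑-*-≥ P f c c≤f = ≤-trans (≤-reflexive (*-distribʳ-sum c P)) (∑-mono-≤ Pc≤Pf)
  where
  Pc≤Pf : ∀ i → P i * c ≤ P i * f i
  Pc≤Pf i with P i in eq
  ... | zero  = z≤n
  ... | suc k = *-monoʳ-≤ (suc k) (c≤f i (subst (0 <_) (sym eq) (s≤s z≤n)))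

∑-*-≡ : ∀ {n} (P f : Fin n → ℕ) c → (∀ i → 0 < P i → f i ≡ c) →
  ∑[ i < n ] (P i * f i) ≡ sum P * c
∑-*-≡ P f c f≡c = ≤-antisym (∑-*-≤ P f c (λ i Pi>0 → ≤-reflexive (f≡c i Pi>0)))
                            (∑-*-≥ P f c (λ i Pi>0 → ≤-reflexive (sym (f≡c i Pi>0))))

∑-pull : ∀ {m n} (P : Fin m → ℕ) (F : Fin m → Fin n → ℕ) →
  ∑[ x < n ] ∑[ y < m ] (P y * F y x) ≡ ∑[ y < m ] (P y * ∑[ x < n ] F y x)
∑-pull P F = trans (∑-comm (λ x y → P y * F y x)) (sum-cong-≗ (λ y → sym (*-distribˡ-sum (P y) (F y))))

∑-*-square : ∀ {n m} (v : Fin n → ℕ) (F : Fin n → Fin m → ℕ) →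
  ∑[ z < n ] (v z * (∑[ w < m ] F z w * ∑[ w < m ] F z w))
    ≡ ∑[ w < m ] ∑[ w′ < m ] ∑[ z < n ] (v z * (F z w * F z w′))
∑-*-square {n} {m} v F = begin
  ∑[ z < n ] (v z * (∑[ w < m ] F z w * ∑[ w < m ] F z w))       ≡⟨ sum-cong-≗ expand ⟩
  ∑[ z < n ] ∑[ w < m ] ∑[ w′ < m ] (v z * (F z w * F z w′))     ≡⟨ ∑-comm (λ z w → ∑[ w′ < m ] (v z * (F z w * F z w′))) ⟩
  ∑[ w < m ] ∑[ z < n ] ∑[ w′ < m ] (v z * (F z w * F z w′))     ≡⟨ sum-cong-≗ (λ w → ∑-comm (λ z w′ → v z * (F z w * F z w′))) ⟩
  ∑[ w < m ] ∑[ w′ < m ] ∑[ z < n ] (v z * (F z w * F z w′))     ∎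
  where
  open ≡-Reasoning
  expand : ∀ z → v z * (∑[ w < m ] F z w * ∑[ w < m ] F z w) ≡ ∑[ w < m ] ∑[ w′ < m ] (v z * (F z w * F z w′))
  expand z = begin
    v z * (sum (F z) * sum (F z))                          ≡⟨ cong (v z *_) (*-distribʳ-sum (sum (F z)) (F z)) ⟩
    v z * ∑[ w < m ] (F z w * sum (F z))                   ≡⟨ *-distribˡ-sum (v z) (λ w → F z w * sum (F z)) ⟩
    ∑[ w < m ] (v z * (F z w * sum (F z)))                 ≡⟨ sum-cong-≗ (λ w → trans (cong (λ a → v z * a) (*-distribˡ-sum (F z w) (F z)))
                                                                                    (*-distribˡ-sum (v z) (λ w′ → F z w * F z w′))) ⟩
    ∑[ w < m ] ∑[ w′ < m ] (v z * (F z w * F z w′))        ∎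

2xy≤x²+y²-ordered : ∀ {x y} → x ≤ y → 2 * x * y ≤ x * x + y * y
2xy≤x²+y²-ordered {x} x≤y = subst (λ z → 2 * x * z ≤ x * x + z * z) (m+[n∸m]≡n x≤y) (gap x _)
  where
  identity : ∀ x d → 2 * x * (x + d) + d * d ≡ x * x + (x + d) * (x + d)
  identity = solve-∀
  gap : ∀ x d → 2 * x * (x + d) ≤ x * x + (x + d) * (x + d)
  gap x d = ≤-trans (m≤m+n _ (d * d)) (≤-reflexive (identity x d))

2xy≤x²+y² : ∀ x y → 2 * x * y ≤ x * x + y * y
2xy≤x²+y² x y with ≤-total x y
... | inj₁ x≤y = 2xy≤x²+y²-ordered x≤y
... | inj₂ y≤x = subst₂ _≤_ (swap y x) (+-comm (y * y) (x * x)) (2xy≤x²+y²-ordered y≤x)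
  where
  swap : ∀ y x → 2 * y * x ≡ 2 * x * y
  swap = solve-∀

-- Sum the weighted AM–GM inequality 2 p q b ≤ (q b)² + p² and take p = ∑ v b, q = ∑ v.
∑-cauchy-schwarz : ∀ {n} (v b : Fin n → ℕ) →
  ∑[ i < n ] (v i * b i) * ∑[ i < n ] (v i * b i) ≤ sum v * ∑[ i < n ] (v i * (b i * b i))
∑-cauchy-schwarz {n} v b with sum v in ∑v≡A
... | zero = ≤-reflexive (cong (λ x → x * x) B≡0)
  where
  B≡0 : ∑[ i < n ] (v i * b i) ≡ 0
  B≡0 = ∑-zero _ λ i → cong (_* b i) (n≤0⇒n≡0 (subst (v i ≤_) ∑v≡A (term≤∑ v i)))
... | suc a = *-cancelˡ-≤ (suc a) (+-cancelʳ-≤ (A * (B * B)) (A * (B * B)) (A * (A * C)) cancellable)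
  where
  open ≤-Reasoning
  A B C : ℕ
  A = suc a
  B = ∑[ i < n ] (v i * b i)
  C = ∑[ i < n ] (v i * (b i * b i))
  pointwise : ∀ p q i → 2 * p * q * (v i * b i) ≤ q * q * (v i * (b i * b i)) + p * p * v i
  pointwise p q i = subst₂ _≤_ (lhs p q (v i) (b i)) (rhs p q (v i) (b i))
                      (*-monoʳ-≤ (v i) (2xy≤x²+y² (q * b i) p))
    where
    lhs : ∀ p q v b → v * (2 * (q * b) * p) ≡ 2 * p * q * (v * b)
    lhs = solve-∀
    rhs : ∀ p q v b → v * (q * b * (q * b) + p * p) ≡ q * q * (v * (b * b)) + p * p * v
    rhs = solve-∀
  weighted-amgm : ∀ p q → 2 * p * q * B ≤ q * q * C + p * p * A
  weighted-amgm p q = begin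
    2 * p * q * B                                    ≡⟨ *-distribˡ-sum (2 * p * q) (λ i → v i * b i) ⟩
    ∑[ i < n ] (2 * p * q * (v i * b i))             ≤⟨ ∑-mono-≤ (pointwise p q) ⟩
    ∑[ i < n ] (q * q * (v i * (b i * b i)) + p * p * v i)
      ≡⟨ ∑-distrib-+ (λ i → q * q * (v i * (b i * b i))) (λ i → p * p * v i) ⟩
    ∑[ i < n ] (q * q * (v i * (b i * b i))) + ∑[ i < n ] (p * p * v i)
      ≡⟨ sym (cong₂ _+_ (*-distribˡ-sum (q * q) (λ i → v i * (b i * b i)))
                        (trans (cong (p * p *_) (sym ∑v≡A)) (*-distribˡ-sum (p * p) v))) ⟩
    q * q * C + p * p * A                            ∎
  cancellable : A * (B * B) + A * (B * B) ≤ A * (A * C) + A * (B * B)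
  cancellable = subst₂ _≤_ (double A B) (regroup A B C) (weighted-amgm B A)
    where
    double : ∀ A B → 2 * B * A * B ≡ A * (B * B) + A * (B * B)
    double = solve-∀
    regroup : ∀ A B C → A * A * C + B * B * A ≡ A * (A * C) + A * (B * B)
    regroup = solve-∀

-- Indicators

-- Counting is done with 0/1-valued indicators: a product of indicators is the
-- indicator of the conjunction, so double counting is rearrangement of sums.

𝟙 : Bool → ℕ
𝟙 true  = 1
𝟙 false = 0

𝟙≤1 : ∀ b → 𝟙 b ≤ 1
𝟙≤1 true  = s≤s z≤n
𝟙≤1 false = z≤n

𝟙-pos⇒≡true : ∀ {b} → 0 < 𝟙 b → b ≡ true
𝟙-pos⇒≡true {true} _ = refl

length-filter-tabulate : ∀ {n} {A : Set} (p : A → Bool) (f : Fin n → A) →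
  length (filterᵇ p (tabulate f)) ≡ sum (𝟙 ∘ p ∘ f)
length-filter-tabulate {zero}  p f = refl
length-filter-tabulate {suc n} p f with p (f zero)
... | true  = cong suc (length-filter-tabulate p (f ∘ suc))
... | false = length-filter-tabulate p (f ∘ suc)

#≡∑𝟙 : ∀ {n} (p : Fin n → Bool) → #[ p ] ≡ sum (𝟙 ∘ p)
#≡∑𝟙 p = length-filter-tabulate p id

⟦_⟧ : ∀ {P : Set} → Dec P → ℕ
⟦ d ⟧ = 𝟙 ⌊ d ⌋

⟦⟧≤1 : ∀ {P : Set} (d : Dec P) → ⟦ d ⟧ ≤ 1
⟦⟧≤1 d = 𝟙≤1 ⌊ d ⌋

⟦⟧-yes : ∀ {P : Set} (d : Dec P) → P → ⟦ d ⟧ ≡ 1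
⟦⟧-yes (yes _) _ = refl
⟦⟧-yes (no ¬p) p = contradiction p ¬p

⟦⟧-no : ∀ {P : Set} (d : Dec P) → ¬ P → ⟦ d ⟧ ≡ 0
⟦⟧-no (yes p) ¬p = contradiction p ¬p
⟦⟧-no (no _)  _  = refl

⟦⟧-pos⇒ : ∀ {P : Set} (d : Dec P) → 0 < ⟦ d ⟧ → P
⟦⟧-pos⇒ (yes p) _ = p

⟦⟧-pos : ∀ {P : Set} (d : Dec P) → P → 0 < ⟦ d ⟧
⟦⟧-pos d p = ≤-reflexive (sym (⟦⟧-yes d p))

⟦⟧-cong : ∀ {P R : Set} (p : Dec P) (r : Dec R) → (P → R) → (R → P) → ⟦ p ⟧ ≡ ⟦ r ⟧
⟦⟧-cong (yes p) r P→R _ = sym (⟦⟧-yes r (P→R p))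
⟦⟧-cong (no ¬p) r _ R→P = sym (⟦⟧-no r (¬p ∘ R→P))

≤1-pos⇒≤ : ∀ {m n} → m ≤ 1 → (0 < m → 0 < n) → m ≤ n
≤1-pos⇒≤ {zero}        _        _   = z≤n
≤1-pos⇒≤ {suc zero}    _        m⇒n = m⇒n (s≤s z≤n)
≤1-pos⇒≤ {suc (suc _)} (s≤s ()) _

≤1-pos⇔⇒≡ : ∀ {m n} → m ≤ 1 → n ≤ 1 → (0 < m → 0 < n) → (0 < n → 0 < m) → m ≡ n
≤1-pos⇔⇒≡ m≤1 n≤1 m⇒n n⇒m = ≤-antisym (≤1-pos⇒≤ m≤1 m⇒n) (≤1-pos⇒≤ n≤1 n⇒m)

≤1⇒*-idem : ∀ {m} → m ≤ 1 → m * m ≡ m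
≤1⇒*-idem {zero}        _        = refl
≤1⇒*-idem {suc zero}    _        = refl
≤1⇒*-idem {suc (suc _)} (s≤s ())

[_≡_] [_≢_] : ∀ {n} → Fin n → Fin n → ℕ
[ i ≡ j ] = ⟦ i ≟ j ⟧
[ i ≢ j ] = ⟦ ¬? (i ≟ j) ⟧

∑[≡] : ∀ {n} (a : Fin n) → ∑[ i < n ] [ i ≡ a ] ≡ 1
∑[≡] a = trans (∑-single _ a (λ i i≢a → ⟦⟧-no (i ≟ a) i≢a)) (⟦⟧-yes (a ≟ a) refl)

∑-split : ∀ {n} (f : Fin n → ℕ) a → sum f ≡ f a + ∑[ i < n ] (f i * [ i ≢ a ])
∑-split {n} f a = begin
  sum f                                                     ≡⟨ sum-cong-≗ split ⟩
  ∑[ i < n ] (f i * [ i ≡ a ] + f i * [ i ≢ a ])            ≡⟨ ∑-distrib-+ (λ i → f i * [ i ≡ a ]) (λ i → f i * [ i ≢ a ]) ⟩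
  ∑[ i < n ] (f i * [ i ≡ a ]) + ∑[ i < n ] (f i * [ i ≢ a ]) ≡⟨ cong (_+ ∑[ i < n ] (f i * [ i ≢ a ])) only-a ⟩
  f a + ∑[ i < n ] (f i * [ i ≢ a ])                        ∎
  where
  open ≡-Reasoning
  split : ∀ i → f i ≡ f i * [ i ≡ a ] + f i * [ i ≢ a ]
  split i with i ≟ a
  ... | yes _ = sym (trans (cong₂ _+_ (*-identityʳ (f i)) (*-zeroʳ (f i))) (+-identityʳ (f i)))
  ... | no  _ = sym (cong₂ _+_ (*-zeroʳ (f i)) (*-identityʳ (f i)))
  only-a : ∑[ i < n ] (f i * [ i ≡ a ]) ≡ f a
  only-a = trans (∑-single _ a (λ i i≢a → trans (cong (f i *_) (⟦⟧-no (i ≟ a) i≢a)) (*-zeroʳ (f i))))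
                 (trans (cong (f a *_) (⟦⟧-yes (a ≟ a) refl)) (*-identityʳ _))

∑-minus : ∀ {n m} (f : Fin n → ℕ) a → sum f ≡ suc m → f a ≡ 1 → ∑[ i < n ] (f i * [ i ≢ a ]) ≡ m
∑-minus {n} f a ∑f≡1+m fa≡1 =
  cong pred (trans (sym (trans (∑-split f a) (cong (_+ ∑[ i < n ] (f i * [ i ≢ a ])) fa≡1))) ∑f≡1+m)

∑-minus₂ : ∀ {n m} (f : Fin n → ℕ) {a b} → a ≢ b → sum f ≡ suc (suc m) → f a ≡ 1 → f b ≡ 1 →
  ∑[ i < n ] (f i * [ i ≢ a ] * [ i ≢ b ]) ≡ m
∑-minus₂ f {a} {b} a≢b ∑f≡2+m fa≡1 fb≡1 =
  ∑-minus (λ i → f i * [ i ≢ a ]) b (∑-minus f a ∑f≡2+m fa≡1)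
          (trans (cong₂ _*_ fb≡1 (⟦⟧-yes (¬? (b ≟ a)) (a≢b ∘ sym))) refl)

-- Orbits and stabilisers

module _ {Q : Geometry} (G : AutGroup Q) where
  open Geometry Q
  open AutGroup G
  open IsGroup isGroup using (assoc; identityˡ; inverseˡ; inverseʳ)

  fixes : Fin np → Fin n → ℕ
  fixes α g = ⟦ actP g α ≟ α ⟧

  stabOrder≡∑fixes : ∀ α → stabOrder α ≡ sum (fixes α)
  stabOrder≡∑fixes α = #≡∑𝟙 (λ g → ⌊ actP g α ≟ α ⌋)

  stabOrder-pos : ∀ α → 0 < stabOrder α
  stabOrder-pos α = subst (0 <_) (sym (stabOrder≡∑fixes α))
                          (≤-trans (⟦⟧-pos (actP ε α ≟ α) (actP-ε α)) (term≤∑ (fixes α) ε))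

  same-image⇒fixes : ∀ {α y h g} → actP h α ≡ y → actP g α ≡ y → actP ((h ⁻¹) ∙ g) α ≡ α
  same-image⇒fixes {α} {y} {h} {g} hα≡y gα≡y = begin
    actP ((h ⁻¹) ∙ g) α       ≡⟨ actP-∙ (h ⁻¹) g α ⟩
    actP (h ⁻¹) (actP g α)    ≡⟨ cong (actP (h ⁻¹)) (trans gα≡y (sym hα≡y)) ⟩
    actP (h ⁻¹) (actP h α)    ≡⟨ actP-∙ (h ⁻¹) h α ⟨
    actP ((h ⁻¹) ∙ h) α       ≡⟨ cong (λ k → actP k α) (inverseˡ h) ⟩
    actP ε α                  ≡⟨ actP-ε α ⟩
    α                         ∎
    where open ≡-Reasoning

  fibre≤stabOrder : PointTransitive → ∀ α y → ∑[ g < n ] [ y ≡ actP g α ] ≤ stabOrder α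
  fibre≤stabOrder transitive α y with transitive α y
  ... | h , hα≡y = begin
    ∑[ g < n ] [ y ≡ actP g α ]                              ≤⟨ ∑-cover _ (fixes α) (λ j g → [ g ≡ h ∙ j ])
                                                                  (λ g → ⟦⟧≤1 (y ≟ actP g α)) covered ⟩
    ∑[ j < n ] (fixes α j * ∑[ g < n ] [ g ≡ h ∙ j ])      ≡⟨ sum-cong-≗ (λ j → trans (cong (fixes α j *_) (∑[≡] (h ∙ j)))
                                                                                     (*-identityʳ (fixes α j))) ⟩
    sum (fixes α)                                            ≡⟨ stabOrder≡∑fixes α ⟨
    stabOrder α                                              ∎
    where
    open ≤-Reasoning
    g≡h[h⁻¹g] : ∀ g → g ≡ h ∙ ((h ⁻¹) ∙ g)
    g≡h[h⁻¹g] g = sym (trans (sym (assoc h (h ⁻¹) g)) (trans (cong (_∙ g) (inverseʳ h)) (identityˡ g)))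
    covered : ∀ g → 0 < [ y ≡ actP g α ] → ∃[ j ] (0 < fixes α j × 0 < [ g ≡ h ∙ j ])
    covered g y≡gα = (h ⁻¹) ∙ g
                   , ⟦⟧-pos (actP ((h ⁻¹) ∙ g) α ≟ α) (same-image⇒fixes hα≡y (sym (⟦⟧-pos⇒ (y ≟ actP g α) y≡gα)))
                   , ⟦⟧-pos (g ≟ h ∙ ((h ⁻¹) ∙ g)) (g≡h[h⁻¹g] g)

  order≤np*stabOrder : PointTransitive → ∀ α → order ≤ np * stabOrder α
  order≤np*stabOrder transitive α = begin
    n                                              ≡⟨ trans (∑-const n 1) (*-identityʳ n) ⟨
    ∑[ g < n ] 1                                   ≡⟨ sum-cong-≗ (λ g → sym (∑[≡] (actP g α))) ⟩
    ∑[ g < n ] ∑[ y < np ] [ y ≡ actP g α ]        ≡⟨ ∑-comm (λ g y → [ y ≡ actP g α ]) ⟩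
    ∑[ y < np ] ∑[ g < n ] [ y ≡ actP g α ]        ≤⟨ ∑-mono-≤ (fibre≤stabOrder transitive α) ⟩
    ∑[ y < np ] stabOrder α                        ≡⟨ ∑-const np (stabOrder α) ⟩
    np * stabOrder α                               ∎
    where open ≤-Reasoning

  lines-through≤stabOrder : FlagTransitive → ∀ α L₀ → I α L₀ ≡ true →
    ∑[ L < nl ] 𝟙 (I α L) ≤ stabOrder α
  lines-through≤stabOrder flagTransitive α L₀ αL₀ = begin
    ∑[ L < nl ] 𝟙 (I α L)                                  ≤⟨ ∑-cover _ (fixes α) (λ g L → [ L ≡ actL g L₀ ])
                                                                (λ L → 𝟙≤1 (I α L)) covered ⟩
    ∑[ g < n ] (fixes α g * ∑[ L < nl ] [ L ≡ actL g L₀ ])  ≡⟨ sum-cong-≗ (λ g → trans (cong (fixes α g *_) (∑[≡] (actL g L₀)))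
                                                                                   (*-identityʳ (fixes α g))) ⟩
    sum (fixes α)                                            ≡⟨ stabOrder≡∑fixes α ⟨
    stabOrder α                                              ∎
    where
    open ≤-Reasoning
    covered : ∀ L → 0 < 𝟙 (I α L) → ∃[ g ] (0 < fixes α g × 0 < [ L ≡ actL g L₀ ])
    covered L αL with flagTransitive α α L₀ L αL₀ (𝟙-pos⇒≡true αL)
    ... | g , gα≡α , gL₀≡L = g , ⟦⟧-pos (actP g α ≟ α) gα≡α , ⟦⟧-pos (L ≟ actL g L₀) (sym gL₀≡L)

-- Arithmetic

-- For non-collinear x, y: higman-a s t = ∑ t_z, higman-b s t ≥ ∑ t_z², and higman-D s t
-- is the number of points collinear with neither x nor y.
higman-a higman-b higman-D : ℕ → ℕ → ℕ
higman-a s t = suc t * ((t ∸ 1) * s)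
higman-b s t = suc t * ((t ∸ 1) * s + t * (t ∸ 1))
higman-D s t = (t ∸ 1) * s + (s ∸ 1) * (t * (s ∸ 1))

-- a² = D b + (t + 1)(t − 1) t (s − 1)(t − s²)
higman-arithmetic : ∀ s t → 2 ≤ s →
  higman-a s t * higman-a s t ≤ higman-D s t * higman-b s t → t ≤ s * s
higman-arithmetic (suc zero) t (s≤s ()) _
higman-arithmetic s@(suc σ@(suc _)) t _ a²≤Db with t ≤? s * s
... | yes t≤s² = t≤s²
... | no  t≰s² = contradiction (+-cancelˡ-≤ (higman-D s t′ * higman-b s t′) _ 0 Db+excess≤Db) λ ()
  where
  k : ℕ
  k = t ∸ suc (s * s)
  t′ : ℕ
  t′ = suc (s * s + k)
  t≡t′ : t ≡ t′
  t≡t′ = sym (m+[n∸m]≡n (≰⇒> t≰s²))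
  -- the identity above at s = 1 + σ, t = 1 + s² + k
  excess : ∀ σ k →
    (2 + (1 + σ) * (1 + σ) + k) * (((1 + σ) * (1 + σ) + k) * (1 + σ))
      * ((2 + (1 + σ) * (1 + σ) + k) * (((1 + σ) * (1 + σ) + k) * (1 + σ)))
    ≡ (((1 + σ) * (1 + σ) + k) * (1 + σ) + σ * ((1 + (1 + σ) * (1 + σ) + k) * σ))
        * ((2 + (1 + σ) * (1 + σ) + k)
           * (((1 + σ) * (1 + σ) + k) * (1 + σ) + (1 + (1 + σ) * (1 + σ) + k) * ((1 + σ) * (1 + σ) + k)))
      + (2 + (1 + σ) * (1 + σ) + k) * ((1 + σ) * (1 + σ) + k) * (1 + (1 + σ) * (1 + σ) + k) * σ * (1 + k)
  excess = solve-∀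
  Db+excess≤Db : higman-D s t′ * higman-b s t′ + _ ≤ higman-D s t′ * higman-b s t′ + 0
  Db+excess≤Db = subst₂ _≤_ (excess σ k) (sym (+-identityʳ _))
                   (subst (λ t → higman-a s t * higman-a s t ≤ higman-D s t * higman-b s t) t≡t′ a²≤Db)

1+t²<[1+t]² : ∀ t → 0 < t → suc (t * t) < suc t * suc t
1+t²<[1+t]² t t>0 = subst (suc (t * t) <_) (square t) (m<m+n (suc (t * t)) (+-mono-≤ t>0 z≤n))
  where
  square : ∀ t → suc (t * t) + (t + t) ≡ suc t * suc t
  square = solve-∀

point-count-arithmetic : ∀ s t → 0 < t → s ≤ t * t → suc s * (suc t * suc s) < suc t ^ 5
point-count-arithmetic s t t>0 s≤t² = begin-strict
  suc s * (suc t * suc s)          ≡⟨ regroup (suc s) (suc t) ⟩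
  suc t * (suc s * suc s)          <⟨ *-monoʳ-< (suc t) (*-mono-< 1+s<u² 1+s<u²) ⟩
  suc t * (u² * u²)                ≡⟨ fifth-power (suc t) ⟩
  suc t ^ 5                        ∎
  where
  open ≤-Reasoning
  u² : ℕ
  u² = suc t * suc t
  1+s<u² : suc s < u²
  1+s<u² = ≤-<-trans (s≤s s≤t²) (1+t²<[1+t]² t t>0)
  regroup : ∀ a u → a * (u * a) ≡ u * (a * a)
  regroup = solve-∀
  fifth-power : ∀ u → u * (u * u * (u * u)) ≡ u * (u * (u * (u * (u * 1))))
  fifth-power = solve-∀

-- Generalised quadrangles

module GQ {Q : Geometry} {s t : ℕ} (H : IsThickGQ Q s t) where
  open Geometry Q
  open IsThickGQ H

  inc : Fin np → Fin nl → ℕ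
  inc x L = 𝟙 (I x L)

  inc-pos : ∀ {x L} → I x L ≡ true → 0 < inc x L
  inc-pos xL = ≤-reflexive (sym (cong 𝟙 xL))

  ∑-points-on : ∀ L → ∑[ x < np ] inc x L ≡ suc s
  ∑-points-on L = trans (sym (#≡∑𝟙 (λ x → I x L))) (linePoints L)

  ∑-lines-through : ∀ x → ∑[ L < nl ] inc x L ≡ suc t
  ∑-lines-through x = trans (sym (#≡∑𝟙 (I x))) (pointLines x)

  line-through : ∀ x → ∃[ L ] (I x L ≡ true)
  line-through x with ∑-pos⇒∃-pos (inc x) (subst (0 <_) (sym (∑-lines-through x)) (s≤s z≤n))
  ... | L , xL = L , 𝟙-pos⇒≡true xL

  -- Every point lies on a line through some point of L₀.
  points-bound : ∀ L₀ → np ≤ suc s * (suc t * suc s)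
  points-bound L₀ = begin
    np                                                         ≡⟨ trans (∑-const np 1) (*-identityʳ np) ⟨
    ∑[ x < np ] 1                                              ≤⟨ ∑-cover _ (λ y → inc y L₀) joins (λ _ → ≤-refl) covered ⟩
    ∑[ y < np ] (inc y L₀ * ∑[ x < np ] joins y x)             ≤⟨ ∑-*-≤ (λ y → inc y L₀) _ _ (λ y _ → ≤-reflexive (∑-joins y)) ⟩
    ∑[ y < np ] inc y L₀ * (suc t * suc s)                     ≡⟨ cong (_* (suc t * suc s)) (∑-points-on L₀) ⟩
    suc s * (suc t * suc s)                                    ∎
    where
    open ≤-Reasoning
    joins : Fin np → Fin np → ℕ
    joins y x = ∑[ M < nl ] (inc y M * inc x M)
    ∑-joins : ∀ y → ∑[ x < np ] joins y x ≡ suc t * suc s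
    ∑-joins y = begin-equality
      ∑[ x < np ] ∑[ M < nl ] (inc y M * inc x M)    ≡⟨ ∑-pull (inc y) (λ M x → inc x M) ⟩
      ∑[ M < nl ] (inc y M * ∑[ x < np ] inc x M)    ≡⟨ sum-cong-≗ (λ M → cong (inc y M *_) (∑-points-on M)) ⟩
      ∑[ M < nl ] (inc y M * suc s)                  ≡⟨ *-distribʳ-sum (suc s) (inc y) ⟨
      ∑[ M < nl ] inc y M * suc s                    ≡⟨ cong (_* suc s) (∑-lines-through y) ⟩
      suc t * suc s                                  ∎
    joined : ∀ {y x M} → I y M ≡ true → I x M ≡ true → 0 < joins y x
    joined {y} {x} {M} yM xM = ≤-trans (*-pos (inc-pos yM) (inc-pos xM)) (term≤∑ (λ M → inc y M * inc x M) M)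
    covered : ∀ x → 0 < 1 → ∃[ y ] (0 < inc y L₀ × 0 < joins y x)
    covered x _ with I x L₀ in xL₀
    ... | true  = x , inc-pos xL₀ , joined xL₀ xL₀
    ... | false with gqAxiomExists x L₀ (λ xL₀′ → contradiction (trans (sym xL₀) xL₀′) λ ())
    ...   | y , yL₀ , M , xM , yM = y , inc-pos yL₀ , joined yM xM

  collinear? : ∀ x y → Dec (Collinear x y)
  collinear? x y = any? (λ M → (I x M ≟ᵇ true) ×-dec (I y M ≟ᵇ true))

  col noncol : Fin np → Fin np → ℕ
  col x y = ⟦ collinear? x y ⟧
  noncol x y = ⟦ ¬? (collinear? x y) ⟧

  collinear-refl : ∀ x → Collinear x x
  collinear-refl x with line-through x
  ... | L , xL = L , xL , xL

  collinear-sym : ∀ {x y} → Collinear x y → Collinear y x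
  collinear-sym (L , xL , yL) = L , yL , xL

  col-sym : ∀ x y → col x y ≡ col y x
  col-sym x y = ⟦⟧-cong (collinear? x y) (collinear? y x) collinear-sym collinear-sym

  inc*inc-pos⇒ : ∀ {x y L} → 0 < inc x L * inc y L → I x L ≡ true × I y L ≡ true
  inc*inc-pos⇒ {x} {y} {L} xyL with *-pos⁻ (inc x L) xyL
  ... | xL , yL = 𝟙-pos⇒≡true xL , 𝟙-pos⇒≡true yL

  ∑-common-lines≡col : ∀ {x y} → x ≢ y → ∑[ L < nl ] (inc x L * inc y L) ≡ col x y
  ∑-common-lines≡col {x} {y} x≢y =
    ≤1-pos⇔⇒≡ at-most-one (⟦⟧≤1 (collinear? x y)) (⟦⟧-pos (collinear? x y) ∘ common-line) (one-line ∘ ⟦⟧-pos⇒ (collinear? x y))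
    where
    at-most-one : ∑[ L < nl ] (inc x L * inc y L) ≤ 1
    at-most-one = ∑-≤1 _ (λ L → *-mono-≤ (𝟙≤1 (I x L)) (𝟙≤1 (I y L))) λ L M xyL xyM →
      let (xL , yL) = inc*inc-pos⇒ xyL ; (xM , yM) = inc*inc-pos⇒ xyM
      in atMostOneLine x y L M x≢y xL yL xM yM
    common-line : 0 < ∑[ L < nl ] (inc x L * inc y L) → Collinear x y
    common-line ∑>0 with ∑-pos⇒∃-pos _ ∑>0
    ... | L , xyL = L , inc*inc-pos⇒ xyL
    one-line : Collinear x y → 0 < ∑[ L < nl ] (inc x L * inc y L)
    one-line (L , xL , yL) = ≤-trans (*-pos (inc-pos xL) (inc-pos yL)) (term≤∑ (λ L → inc x L * inc y L) L)

  s≡1+[s∸1] : s ≡ suc (s ∸ 1)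
  s≡1+[s∸1] = sym (m+[n∸m]≡n (<⇒≤ s≥2))

  t≡1+[t∸1] : t ≡ suc (t ∸ 1)
  t≡1+[t∸1] = sym (m+[n∸m]≡n (<⇒≤ t≥2))

  ∑-other-points-on : ∀ {a L} → I a L ≡ true → ∑[ x < np ] (inc x L * [ x ≢ a ]) ≡ s
  ∑-other-points-on {a} {L} aL = ∑-minus (λ x → inc x L) a (∑-points-on L) (cong 𝟙 aL)

  ∑-other-points-on₂ : ∀ {a b L} → a ≢ b → I a L ≡ true → I b L ≡ true →
    ∑[ x < np ] (inc x L * [ x ≢ a ] * [ x ≢ b ]) ≡ s ∸ 1
  ∑-other-points-on₂ {L = L} a≢b aL bL =
    ∑-minus₂ (λ x → inc x L) a≢b (trans (∑-points-on L) (cong suc s≡1+[s∸1])) (cong 𝟙 aL) (cong 𝟙 bL)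

  ∑-other-lines-through : ∀ {x K} → I x K ≡ true → ∑[ L < nl ] (inc x L * [ L ≢ K ]) ≡ t
  ∑-other-lines-through {x} {K} xK = ∑-minus (inc x) K (∑-lines-through x) (cong 𝟙 xK)

  ∑-other-lines-through₂ : ∀ {x K K′} → K ≢ K′ → I x K ≡ true → I x K′ ≡ true →
    ∑[ L < nl ] (inc x L * [ L ≢ K ] * [ L ≢ K′ ]) ≡ t ∸ 1
  ∑-other-lines-through₂ {x} K≢K′ xK xK′ =
    ∑-minus₂ (inc x) K≢K′ (trans (∑-lines-through x) (cong suc t≡1+[t∸1])) (cong 𝟙 xK) (cong 𝟙 xK′)

  no-triangle : ∀ {p w z K M} → p ≢ w → z ≢ w → M ≢ K → I p K ≡ true → I w K ≡ true →
    I w M ≡ true → I z M ≡ true → ¬ Collinear p z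
  no-triangle {p} {w} {z} {K} {M} p≢w z≢w M≢K pK wK wM zM p~z with I p M in pM
  ... | true  = M≢K (atMostOneLine p w M K p≢w pM wM pK wK)
  ... | false = z≢w (gqAxiomUnique p M (λ pM′ → contradiction (trans (sym pM) pM′) λ ())
                       z w zM p~z wM (K , pK , wK))

  ∑-collinear-on≡1 : ∀ {v L} → I v L ≢ true → ∑[ w < np ] (inc w L * col v w) ≡ 1
  ∑-collinear-on≡1 {v} {L} v∉L = ≤-antisym at-most-one at-least-one
    where
    on-line-collinear : ∀ {w} → 0 < inc w L * col v w → I w L ≡ true × Collinear v w
    on-line-collinear {w} wL~v with *-pos⁻ (inc w L) wL~v
    ... | wL , v~w = 𝟙-pos⇒≡true wL , ⟦⟧-pos⇒ (collinear? v w) v~w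
    at-most-one : ∑[ w < np ] (inc w L * col v w) ≤ 1
    at-most-one = ∑-≤1 _ (λ w → *-mono-≤ (𝟙≤1 (I w L)) (⟦⟧≤1 (collinear? v w))) λ w w′ w∈ w′∈ →
      let (wL , v~w) = on-line-collinear w∈ ; (w′L , v~w′) = on-line-collinear w′∈
      in gqAxiomUnique v L v∉L w w′ wL v~w w′L v~w′
    at-least-one : 1 ≤ ∑[ w < np ] (inc w L * col v w)
    at-least-one with gqAxiomExists v L v∉L
    ... | w , wL , v~w = ≤-trans (*-pos (inc-pos wL) (⟦⟧-pos (collinear? v w) v~w))
                                 (term≤∑ (λ w → inc w L * col v w) w)

  trace-size : ∀ {u v} → ¬ Collinear u v → ∑[ w < np ] (col u w * col v w) ≡ suc t
  trace-size {u} {v} u≁v = begin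
    ∑[ w < np ] (col u w * col v w)                              ≡⟨ sum-cong-≗ via-lines ⟩
    ∑[ w < np ] ∑[ L < nl ] (inc u L * (inc w L * col v w))      ≡⟨ ∑-pull (inc u) (λ L w → inc w L * col v w) ⟩
    ∑[ L < nl ] (inc u L * ∑[ w < np ] (inc w L * col v w))      ≡⟨ sum-cong-≗ one-per-line ⟩
    ∑[ L < nl ] inc u L                                          ≡⟨ ∑-lines-through u ⟩
    suc t                                                        ∎
    where
    open ≡-Reasoning
    common-lines : ∀ w → col u w * col v w ≡ ∑[ L < nl ] (inc u L * inc w L) * col v w
    common-lines w with w ≟ u
    ... | yes w≡u = begin
      col u w * col v w    ≡⟨ cong (col u w *_) v≁w ⟩
      col u w * 0          ≡⟨ *-zeroʳ (col u w) ⟩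
      0                    ≡⟨ *-zeroʳ common ⟨
      common * 0           ≡⟨ cong (common *_) v≁w ⟨
      common * col v w     ∎
      where
      common : ℕ
      common = ∑[ L < nl ] (inc u L * inc w L)
      v≁w : col v w ≡ 0
      v≁w = ⟦⟧-no (collinear? v w) (λ v~w → u≁v (collinear-sym (subst (Collinear v) w≡u v~w)))
    ... | no w≢u = cong (_* col v w) (sym (∑-common-lines≡col (w≢u ∘ sym)))
    via-lines : ∀ w → col u w * col v w ≡ ∑[ L < nl ] (inc u L * (inc w L * col v w))
    via-lines w = trans (common-lines w) (trans (*-distribʳ-sum (col v w) (λ L → inc u L * inc w L))
                                           (sum-cong-≗ (λ L → *-assoc (inc u L) (inc w L) (col v w))))
    one-per-line : ∀ L → inc u L * ∑[ w < np ] (inc w L * col v w) ≡ inc u L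
    one-per-line L with I u L in uL
    ... | true  = trans (+-identityʳ _) (∑-collinear-on≡1 (λ vL → u≁v (L , uL , vL)))
    ... | false = refl

  NeighbourVia : Fin np → Fin nl → Fin nl → Fin np → Fin nl → Set
  NeighbourVia w K K′ z M = I w M ≡ true × M ≢ K × M ≢ K′ × I z M ≡ true × z ≢ w

  neighbours-via : Fin np → Fin nl → Fin nl → Fin np → Fin nl → ℕ
  neighbours-via w K K′ z M = inc w M * [ M ≢ K ] * [ M ≢ K′ ] * (inc z M * [ z ≢ w ])

  neighbours-off : Fin np → Fin nl → Fin nl → Fin np → ℕ
  neighbours-off w K K′ z = ∑[ M < nl ] neighbours-via w K K′ z M

  neighbours-via-pos⇒ : ∀ {w K K′ z M} → 0 < neighbours-via w K K′ z M → NeighbourVia w K K′ z M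
  neighbours-via-pos⇒ {w} {K} {K′} {z} {M} via>0 with *-pos⁻ (inc w M * [ M ≢ K ] * [ M ≢ K′ ]) via>0
  ... | wMKK′ , zMw with *-pos⁻₃ (inc w M) [ M ≢ K ] wMKK′ | *-pos⁻ (inc z M) zMw
  ... | wM , M≢K , M≢K′ | zM , z≢w = 𝟙-pos⇒≡true wM , ⟦⟧-pos⇒ (¬? (M ≟ K)) M≢K , ⟦⟧-pos⇒ (¬? (M ≟ K′)) M≢K′
                                   , 𝟙-pos⇒≡true zM , ⟦⟧-pos⇒ (¬? (z ≟ w)) z≢w

  neighbours-off-pos⇒ : ∀ {w K K′ z} → 0 < neighbours-off w K K′ z → ∃[ M ] NeighbourVia w K K′ z M
  neighbours-off-pos⇒ nb>0 with ∑-pos⇒∃-pos _ nb>0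
  ... | M , via>0 = M , neighbours-via-pos⇒ via>0

  neighbours-off-pos : ∀ {w K K′ z M} → NeighbourVia w K K′ z M → 0 < neighbours-off w K K′ z
  neighbours-off-pos {w} {K} {K′} {z} {M} (wM , M≢K , M≢K′ , zM , z≢w) =
    ≤-trans (*-pos (*-pos (*-pos (inc-pos wM) (⟦⟧-pos (¬? (M ≟ K)) M≢K)) (⟦⟧-pos (¬? (M ≟ K′)) M≢K′))
                   (*-pos (inc-pos zM) (⟦⟧-pos (¬? (z ≟ w)) z≢w)))
            (term≤∑ (neighbours-via w K K′ z) M)

  neighbours-off≤1 : ∀ w K K′ z → neighbours-off w K K′ z ≤ 1
  neighbours-off≤1 w K K′ z = ∑-≤1 _ via≤1 λ M M′ M∈ M′∈ →
    let (wM , _ , _ , zM , z≢w) = neighbours-via-pos⇒ M∈ ; (wM′ , _ , _ , zM′ , _) = neighbours-via-pos⇒ M′∈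
    in atMostOneLine z w M M′ z≢w zM wM zM′ wM′
    where
    via≤1 : ∀ M → neighbours-via w K K′ z M ≤ 1
    via≤1 M = *-mono-≤ (*-mono-≤ (*-mono-≤ (𝟙≤1 (I w M)) (⟦⟧≤1 (¬? (M ≟ K)))) (⟦⟧≤1 (¬? (M ≟ K′))))
                       (*-mono-≤ (𝟙≤1 (I z M)) (⟦⟧≤1 (¬? (z ≟ w))))

  ∑-neighbours-off : ∀ {w K K′} → K ≢ K′ → I w K ≡ true → I w K′ ≡ true →
    ∑[ z < np ] neighbours-off w K K′ z ≡ (t ∸ 1) * s
  ∑-neighbours-off {w} {K} {K′} K≢K′ wK wK′ = begin
    ∑[ z < np ] neighbours-off w K K′ z                           ≡⟨ ∑-pull other-line (λ M z → inc z M * [ z ≢ w ]) ⟩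
    ∑[ M < nl ] (other-line M * ∑[ z < np ] (inc z M * [ z ≢ w ])) ≡⟨ ∑-*-≡ other-line _ s on-other-line ⟩
    sum other-line * s                                            ≡⟨ cong (_* s) (∑-other-lines-through₂ K≢K′ wK wK′) ⟩
    (t ∸ 1) * s                                                   ∎
    where
    open ≡-Reasoning
    other-line : Fin nl → ℕ
    other-line M = inc w M * [ M ≢ K ] * [ M ≢ K′ ]
    on-other-line : ∀ M → 0 < other-line M → ∑[ z < np ] (inc z M * [ z ≢ w ]) ≡ s
    on-other-line M wM = ∑-other-points-on (𝟙-pos⇒≡true (proj₁ (*-pos⁻₃ (inc w M) [ M ≢ K ] wM)))

  module Higman {x y : Fin np} (x≁y : ¬ Collinear x y) where

    -- trace is the indicator of {x, y}^⊥ and traceDegree z = |{x, y, z}^⊥|.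
    trace far traceDegree : Fin np → ℕ
    trace w = col x w * col y w
    far z = noncol x z * noncol y z
    traceDegree z = ∑[ w < np ] (trace w * col z w)

    trace-pos⇒ : ∀ {w} → 0 < trace w → Collinear x w × Collinear y w
    trace-pos⇒ {w} w∈ with *-pos⁻ (col x w) w∈
    ... | x~w , y~w = ⟦⟧-pos⇒ (collinear? x w) x~w , ⟦⟧-pos⇒ (collinear? y w) y~w

    trace≤1 : ∀ w → trace w ≤ 1
    trace≤1 w = *-mono-≤ (⟦⟧≤1 (collinear? x w)) (⟦⟧≤1 (collinear? y w))

    ∑-trace : sum trace ≡ suc t
    ∑-trace = trace-size x≁y

    far-pos⇒ : ∀ {z} → 0 < far z → ¬ Collinear x z × ¬ Collinear y z
    far-pos⇒ {z} z-far with *-pos⁻ (noncol x z) z-far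
    ... | x≁z , y≁z = ⟦⟧-pos⇒ (¬? (collinear? x z)) x≁z , ⟦⟧-pos⇒ (¬? (collinear? y z)) y≁z

    far-pos : ∀ {z} → ¬ Collinear x z → ¬ Collinear y z → 0 < far z
    far-pos {z} x≁z y≁z = *-pos (⟦⟧-pos (¬? (collinear? x z)) x≁z) (⟦⟧-pos (¬? (collinear? y z)) y≁z)

    far≤1 : ∀ z → far z ≤ 1
    far≤1 z = *-mono-≤ (⟦⟧≤1 (¬? (collinear? x z))) (⟦⟧≤1 (¬? (collinear? y z)))

    module _ {w Kx Ky} (xKx : I x Kx ≡ true) (wKx : I w Kx ≡ true) (yKy : I y Ky ≡ true) (wKy : I w Ky ≡ true) where

      Kx≢Ky : Kx ≢ Ky
      Kx≢Ky refl = x≁y (Kx , xKx , yKy)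

      x≢w : x ≢ w
      x≢w refl = x≁y (Ky , wKy , yKy)

      y≢w : y ≢ w
      y≢w refl = x≁y (Kx , xKx , wKx)

      far-neighbours≡ : ∀ z → far z * col z w ≡ neighbours-off w Kx Ky z
      far-neighbours≡ z = ≤1-pos⇔⇒≡ (*-mono-≤ (far≤1 z) (⟦⟧≤1 (collinear? z w))) (neighbours-off≤1 w Kx Ky z)
                                     via-neighbour via-far
        where
        via-neighbour : 0 < far z * col z w → 0 < neighbours-off w Kx Ky z
        via-neighbour far~w with *-pos⁻ (far z) far~w
        ... | z-far , z~w with far-pos⇒ z-far | ⟦⟧-pos⇒ (collinear? z w) z~w
        ... | x≁z , y≁z | M , zM , wM = neighbours-off-pos (wM , M≢Kx , M≢Ky , zM , z≢w)
          where
          M≢Kx : M ≢ Kx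
          M≢Kx refl = x≁z (M , xKx , zM)
          M≢Ky : M ≢ Ky
          M≢Ky refl = y≁z (M , yKy , zM)
          z≢w : z ≢ w
          z≢w refl = x≁z (Kx , xKx , wKx)
        via-far : 0 < neighbours-off w Kx Ky z → 0 < far z * col z w
        via-far nb>0 with neighbours-off-pos⇒ nb>0
        ... | M , wM , M≢Kx , M≢Ky , zM , z≢w =
          *-pos (far-pos (no-triangle x≢w z≢w M≢Kx xKx wKx wM zM) (no-triangle y≢w z≢w M≢Ky yKy wKy wM zM))
                (⟦⟧-pos (collinear? z w) (M , zM , wM))

      ∑-far-neighbours : ∑[ z < np ] (far z * col z w) ≡ (t ∸ 1) * s
      ∑-far-neighbours = trans (sum-cong-≗ far-neighbours≡) (∑-neighbours-off Kx≢Ky wKx wKy)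

      -- A far point z is collinear with a unique point u of Kx.  Either u = w, or
      -- u ∈ Kx ∖ {x, w} and z lies on a line M ≠ Kx through u, off u and off the
      -- point of M collinear with y.
      Kx-point : Fin np → ℕ
      Kx-point u = inc u Kx * [ u ≢ x ] * [ u ≢ w ]

      non-Kx-line : Fin np → Fin nl → ℕ
      non-Kx-line u M = inc u M * [ M ≢ Kx ]

      y-far-on : Fin np → Fin nl → Fin np → ℕ
      y-far-on u M z = inc z M * [ z ≢ u ] * noncol y z

      far-via-Kx : Fin np → ℕ
      far-via-Kx z = ∑[ u < np ] (Kx-point u * ∑[ M < nl ] (non-Kx-line u M * y-far-on u M z))

      Kx-point-pos⇒ : ∀ {u} → 0 < Kx-point u → I u Kx ≡ true × u ≢ x × u ≢ w
      Kx-point-pos⇒ {u} u∈ with *-pos⁻₃ (inc u Kx) [ u ≢ x ] u∈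
      ... | uKx , u≢x , u≢w = 𝟙-pos⇒≡true uKx , ⟦⟧-pos⇒ (¬? (u ≟ x)) u≢x , ⟦⟧-pos⇒ (¬? (u ≟ w)) u≢w

      y∉Kx : I y Kx ≢ true
      y∉Kx yKx = x≁y (Kx , xKx , yKx)

      Kx-collinear-with-y⇒w : ∀ {u} → I u Kx ≡ true → Collinear y u → u ≡ w
      Kx-collinear-with-y⇒w uKx y~u = gqAxiomUnique y Kx y∉Kx _ w uKx y~u wKx (Ky , yKy , wKy)

      ∑-y-far-on≤ : ∀ {u M} → 0 < Kx-point u → 0 < non-Kx-line u M →
        ∑[ z < np ] y-far-on u M z ≤ s ∸ 1
      ∑-y-far-on≤ {u} {M} u∈ M∈ with Kx-point-pos⇒ u∈ | *-pos⁻ (inc u M) M∈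
      ... | uKx , _ , u≢w | uM , _
        with gqAxiomExists y M (λ yM → u≢w (Kx-collinear-with-y⇒w uKx (M , yM , 𝟙-pos⇒≡true uM)))
      ... | v , vM , y~v = begin
        ∑[ z < np ] y-far-on u M z                          ≤⟨ ∑-mono-≤ (λ z → ≤1-pos⇒≤ (y-far-on≤1 z) (other-than-v z)) ⟩
        ∑[ z < np ] (inc z M * [ z ≢ u ] * [ z ≢ v ])       ≡⟨ ∑-other-points-on₂ u≢v (𝟙-pos⇒≡true uM) vM ⟩
        s ∸ 1                                               ∎
        where
        open ≤-Reasoning
        u≢v : u ≢ v
        u≢v refl = u≢w (Kx-collinear-with-y⇒w uKx y~v)
        y-far-on≤1 : ∀ z → y-far-on u M z ≤ 1
        y-far-on≤1 z = *-mono-≤ (*-mono-≤ (𝟙≤1 (I z M)) (⟦⟧≤1 (¬? (z ≟ u)))) (⟦⟧≤1 (¬? (collinear? y z)))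
        other-than-v : ∀ z → 0 < y-far-on u M z → 0 < inc z M * [ z ≢ u ] * [ z ≢ v ]
        other-than-v z z∈ with *-pos⁻₃ (inc z M) [ z ≢ u ] z∈
        ... | zM , z≢u , y≁z = *-pos (*-pos zM z≢u)
          (⟦⟧-pos (¬? (z ≟ v)) λ { refl → ⟦⟧-pos⇒ (¬? (collinear? y z)) y≁z y~v })

      ∑-far-via-Kx≤ : sum far-via-Kx ≤ (s ∸ 1) * (t * (s ∸ 1))
      ∑-far-via-Kx≤ = begin
        sum far-via-Kx
          ≡⟨ ∑-pull Kx-point (λ u z → ∑[ M < nl ] (non-Kx-line u M * y-far-on u M z)) ⟩
        ∑[ u < np ] (Kx-point u * ∑[ z < np ] ∑[ M < nl ] (non-Kx-line u M * y-far-on u M z))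
          ≤⟨ ∑-*-≤ Kx-point _ _ per-point ⟩
        sum Kx-point * (t * (s ∸ 1))
          ≡⟨ cong (_* (t * (s ∸ 1))) (∑-other-points-on₂ x≢w xKx wKx) ⟩
        (s ∸ 1) * (t * (s ∸ 1)) ∎
        where
        open ≤-Reasoning
        per-point : ∀ u → 0 < Kx-point u →
          ∑[ z < np ] ∑[ M < nl ] (non-Kx-line u M * y-far-on u M z) ≤ t * (s ∸ 1)
        per-point u u∈ = begin
          ∑[ z < np ] ∑[ M < nl ] (non-Kx-line u M * y-far-on u M z)
            ≡⟨ ∑-pull (non-Kx-line u) (y-far-on u) ⟩
          ∑[ M < nl ] (non-Kx-line u M * ∑[ z < np ] y-far-on u M z)
            ≤⟨ ∑-*-≤ (non-Kx-line u) _ _ (λ M → ∑-y-far-on≤ u∈) ⟩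
          sum (non-Kx-line u) * (s ∸ 1)
            ≡⟨ cong (_* (s ∸ 1)) (∑-other-lines-through (proj₁ (Kx-point-pos⇒ u∈))) ⟩
          t * (s ∸ 1) ∎

      far≤neighbours+via-Kx : ∀ z → far z ≤ neighbours-off w Kx Ky z + far-via-Kx z
      far≤neighbours+via-Kx z = ≤1-pos⇒≤ (far≤1 z) covered
        where
        covered : 0 < far z → 0 < neighbours-off w Kx Ky z + far-via-Kx z
        covered z-far with far-pos⇒ z-far
        ... | x≁z , y≁z with gqAxiomExists z Kx (λ zKx → x≁z (Kx , xKx , zKx))
        ... | u , uKx , M , zM , uM = joined (u ≟ w)
          where
          M≢Kx : M ≢ Kx
          M≢Kx refl = x≁z (M , xKx , zM)
          z≢u : z ≢ u
          z≢u refl = x≁z (Kx , xKx , uKx)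
          joined : Dec (u ≡ w) → 0 < neighbours-off w Kx Ky z + far-via-Kx z
          joined (yes u≡w) = ≤-trans (neighbours-off-pos (subst (λ v → I v M ≡ true) u≡w uM , M≢Kx
                                                        , (λ { refl → y≁z (M , yKy , zM) }) , zM , subst (z ≢_) u≡w z≢u))
                                     (m≤m+n _ _)
          joined (no u≢w) = ≤-trans (≤-trans u-term (term≤∑ _ u)) (m≤n+m _ _)
            where
            M-term : 0 < non-Kx-line u M * y-far-on u M z
            M-term = *-pos (*-pos (inc-pos uM) (⟦⟧-pos (¬? (M ≟ Kx)) M≢Kx))
                           (*-pos (*-pos (inc-pos zM) (⟦⟧-pos (¬? (z ≟ u)) z≢u)) (⟦⟧-pos (¬? (collinear? y z)) y≁z))
            u-term : 0 < Kx-point u * ∑[ M < nl ] (non-Kx-line u M * y-far-on u M z)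
            u-term = *-pos (*-pos (*-pos (inc-pos uKx) (⟦⟧-pos (¬? (u ≟ x)) λ { refl → x≁z (M , uM , zM) }))
                                  (⟦⟧-pos (¬? (u ≟ w)) u≢w))
                           (≤-trans M-term (term≤∑ (λ M → non-Kx-line u M * y-far-on u M z) M))

      ∑-far≤ : sum far ≤ higman-D s t
      ∑-far≤ = begin
        sum far                                                 ≤⟨ ∑-mono-≤ far≤neighbours+via-Kx ⟩
        ∑[ z < np ] (neighbours-off w Kx Ky z + far-via-Kx z)   ≡⟨ ∑-distrib-+ (neighbours-off w Kx Ky) far-via-Kx ⟩
        ∑[ z < np ] neighbours-off w Kx Ky z + sum far-via-Kx   ≤⟨ +-mono-≤ (≤-reflexive (∑-neighbours-off Kx≢Ky wKx wKy)) ∑-far-via-Kx≤ ⟩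
        higman-D s t                                            ∎
        where open ≤-Reasoning

    trace-lines : ∀ {w} → 0 < trace w → ∃[ Kx ] ∃[ Ky ] (I x Kx ≡ true × I w Kx ≡ true × I y Ky ≡ true × I w Ky ≡ true)
    trace-lines w∈ with trace-pos⇒ w∈
    ... | (Kx , xKx , wKx) , (Ky , yKy , wKy) = Kx , Ky , xKx , wKx , yKy , wKy

    ∑-far-neighbours-of-trace : ∀ {w} → 0 < trace w → ∑[ z < np ] (far z * col z w) ≡ (t ∸ 1) * s
    ∑-far-neighbours-of-trace w∈ with trace-lines w∈
    ... | _ , _ , xKx , wKx , yKy , wKy = ∑-far-neighbours xKx wKx yKy wKy

    trace-noncollinear : ∀ {w w′} → 0 < trace w → 0 < trace w′ → w ≢ w′ → ¬ Collinear w w′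
    trace-noncollinear {w} {w′} w∈ w′∈ w≢w′ (K , wK , w′K) with trace-pos⇒ w∈ | trace-pos⇒ w′∈ | I x K in xK
    ... | _ , y~w | _ , y~w′ | true  =
      w≢w′ (gqAxiomUnique y K (λ yK → x≁y (K , xK , yK)) w w′ wK y~w w′K y~w′)
    ... | x~w , _ | x~w′ , _ | false =
      w≢w′ (gqAxiomUnique x K (λ xK′ → contradiction (trans (sym xK) xK′) λ ()) w w′ wK x~w w′K x~w′)

    common-far : Fin np → Fin np → ℕ
    common-far w w′ = ∑[ z < np ] (far z * (col z w * col z w′))

    ∑-common-far≤ : ∀ {w w′} → 0 < trace w → 0 < trace w′ → w ≢ w′ → common-far w w′ ≤ t ∸ 1
    ∑-common-far≤ {w} {w′} w∈ w′∈ w≢w′ = begin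
      common-far w w′                                           ≤⟨ ∑-mono-≤ far⇒in-trace-minus-xy ⟩
      ∑[ z < np ] (col w z * col w′ z * [ z ≢ x ] * [ z ≢ y ])  ≡⟨ ∑-minus₂ (λ z → col w z * col w′ z) x≢y ∑-trace-ww′
                                                                     (in-trace (proj₁ (trace-pos⇒ w∈)) (proj₁ (trace-pos⇒ w′∈)))
                                                                     (in-trace (proj₂ (trace-pos⇒ w∈)) (proj₂ (trace-pos⇒ w′∈))) ⟩
      t ∸ 1                                                     ∎
      where
      open ≤-Reasoning
      x≢y : x ≢ y
      x≢y refl = x≁y (collinear-refl x)
      ∑-trace-ww′ : ∑[ z < np ] (col w z * col w′ z) ≡ suc (suc (t ∸ 1))
      ∑-trace-ww′ = trans (trace-size (trace-noncollinear w∈ w′∈ w≢w′)) (cong suc t≡1+[t∸1])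
      in-trace : ∀ {v} → Collinear v w → Collinear v w′ → col w v * col w′ v ≡ 1
      in-trace v~w v~w′ = cong₂ _*_ (⟦⟧-yes (collinear? w _) (collinear-sym v~w)) (⟦⟧-yes (collinear? w′ _) (collinear-sym v~w′))
      far⇒in-trace-minus-xy : ∀ z → far z * (col z w * col z w′) ≤ col w z * col w′ z * [ z ≢ x ] * [ z ≢ y ]
      far⇒in-trace-minus-xy z = ≤1-pos⇒≤ (*-mono-≤ (far≤1 z) (*-mono-≤ (⟦⟧≤1 (collinear? z w)) (⟦⟧≤1 (collinear? z w′)))) positive
        where
        positive : 0 < far z * (col z w * col z w′) → 0 < col w z * col w′ z * [ z ≢ x ] * [ z ≢ y ]
        positive lhs>0 with *-pos⁻ (far z) lhs>0
        ... | z-far , zww′ with far-pos⇒ z-far | *-pos⁻ (col z w) zww′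
        ... | x≁z , y≁z | z~w , z~w′ =
          *-pos (*-pos (*-pos (⟦⟧-pos (collinear? w z) (collinear-sym (⟦⟧-pos⇒ (collinear? z w) z~w)))
                              (⟦⟧-pos (collinear? w′ z) (collinear-sym (⟦⟧-pos⇒ (collinear? z w′) z~w′))))
                       (⟦⟧-pos (¬? (z ≟ x)) λ { refl → x≁z (collinear-refl z) }))
                (⟦⟧-pos (¬? (z ≟ y)) λ { refl → y≁z (collinear-refl z) })

    ∑-far*traceDegree : ∑[ z < np ] (far z * traceDegree z) ≡ higman-a s t
    ∑-far*traceDegree = begin
      ∑[ z < np ] (far z * traceDegree z)                           ≡⟨ sum-cong-≗ distribute ⟩
      ∑[ z < np ] ∑[ w < np ] (trace w * (far z * col z w))         ≡⟨ ∑-pull trace (λ w z → far z * col z w) ⟩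
      ∑[ w < np ] (trace w * ∑[ z < np ] (far z * col z w))         ≡⟨ ∑-*-≡ trace _ _ (λ w → ∑-far-neighbours-of-trace) ⟩
      sum trace * ((t ∸ 1) * s)                                     ≡⟨ cong (_* ((t ∸ 1) * s)) ∑-trace ⟩
      higman-a s t                                                  ∎
      where
      open ≡-Reasoning
      distribute : ∀ z → far z * traceDegree z ≡ ∑[ w < np ] (trace w * (far z * col z w))
      distribute z = trans (*-distribˡ-sum (far z) (λ w → trace w * col z w))
                           (sum-cong-≗ (λ w → x∙yz≈y∙xz (far z) (trace w) (col z w)))

    trace-row≤ : ∀ {w} → 0 < trace w → ∑[ w′ < np ] (trace w′ * common-far w w′) ≤ (t ∸ 1) * s + t * (t ∸ 1)
    trace-row≤ {w} w∈ = begin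
      ∑[ w′ < np ] (trace w′ * common-far w w′)                          ≡⟨ ∑-split (λ w′ → trace w′ * common-far w w′) w ⟩
      trace w * common-far w w + ∑[ w′ < np ] (trace w′ * common-far w w′ * [ w′ ≢ w ])
        ≤⟨ +-mono-≤ diagonal off-diagonal ⟩
      (t ∸ 1) * s + t * (t ∸ 1)                                          ∎
      where
      open ≤-Reasoning
      diagonal : trace w * common-far w w ≤ (t ∸ 1) * s
      diagonal = begin
        trace w * common-far w w                        ≤⟨ *-monoˡ-≤ (common-far w w) (trace≤1 w) ⟩
        common-far w w + 0                              ≡⟨ +-identityʳ _ ⟩
        ∑[ z < np ] (far z * (col z w * col z w))       ≡⟨ sum-cong-≗ (λ z → cong (far z *_) (≤1⇒*-idem (⟦⟧≤1 (collinear? z w)))) ⟩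
        ∑[ z < np ] (far z * col z w)                   ≡⟨ ∑-far-neighbours-of-trace w∈ ⟩
        (t ∸ 1) * s                                     ∎
      other-trace : Fin np → ℕ
      other-trace w′ = trace w′ * [ w′ ≢ w ]
      off-diagonal : ∑[ w′ < np ] (trace w′ * common-far w w′ * [ w′ ≢ w ]) ≤ t * (t ∸ 1)
      off-diagonal = begin
        ∑[ w′ < np ] (trace w′ * common-far w w′ * [ w′ ≢ w ])  ≡⟨ sum-cong-≗ (λ w′ → xy∙z≈xz∙y (trace w′) (common-far w w′) [ w′ ≢ w ]) ⟩
        ∑[ w′ < np ] (other-trace w′ * common-far w w′)         ≤⟨ ∑-*-≤ other-trace _ _ bounded ⟩
        sum other-trace * (t ∸ 1)                               ≡⟨ cong (_* (t ∸ 1)) (∑-minus trace w ∑-trace (≤-antisym (trace≤1 w) w∈)) ⟩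
        t * (t ∸ 1)                                             ∎
        where
        bounded : ∀ w′ → 0 < other-trace w′ → common-far w w′ ≤ t ∸ 1
        bounded w′ w′∈ with *-pos⁻ (trace w′) w′∈
        ... | w′∈trace , w′≢w = ∑-common-far≤ w∈ w′∈trace (⟦⟧-pos⇒ (¬? (w′ ≟ w)) w′≢w ∘ sym)

    ∑-far*traceDegree²≤ : ∑[ z < np ] (far z * (traceDegree z * traceDegree z)) ≤ higman-b s t
    ∑-far*traceDegree²≤ = begin
      ∑[ z < np ] (far z * (traceDegree z * traceDegree z))
        ≡⟨ ∑-*-square far (λ z w → trace w * col z w) ⟩
      ∑[ w < np ] ∑[ w′ < np ] ∑[ z < np ] (far z * (trace w * col z w * (trace w′ * col z w′)))
        ≡⟨ sum-cong-≗ (λ w → trans (sum-cong-≗ (λ w′ → factor-trace w w′)) (sym (*-distribˡ-sum (trace w) (λ w′ → trace w′ * common-far w w′)))) ⟩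
      ∑[ w < np ] (trace w * ∑[ w′ < np ] (trace w′ * common-far w w′))
        ≤⟨ ∑-*-≤ trace _ _ (λ w → trace-row≤) ⟩
      sum trace * ((t ∸ 1) * s + t * (t ∸ 1))
        ≡⟨ cong (_* ((t ∸ 1) * s + t * (t ∸ 1))) ∑-trace ⟩
      higman-b s t ∎
      where
      open ≤-Reasoning
      factor-trace : ∀ w w′ → ∑[ z < np ] (far z * (trace w * col z w * (trace w′ * col z w′)))
                              ≡ trace w * (trace w′ * common-far w w′)
      factor-trace w w′ = begin-equality
        ∑[ z < np ] (far z * (trace w * col z w * (trace w′ * col z w′)))   ≡⟨ sum-cong-≗ (λ z → regroup (far z) (trace w) (col z w) (trace w′) (col z w′)) ⟩
        ∑[ z < np ] (trace w * (trace w′ * (far z * (col z w * col z w′)))) ≡⟨ *-distribˡ-sum (trace w) (λ z → trace w′ * (far z * (col z w * col z w′))) ⟨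
        trace w * ∑[ z < np ] (trace w′ * (far z * (col z w * col z w′)))   ≡⟨ cong (trace w *_) (*-distribˡ-sum (trace w′) (λ z → far z * (col z w * col z w′))) ⟨
        trace w * (trace w′ * common-far w w′)                              ∎
        where
        regroup : ∀ v a b a′ b′ → v * (a * b * (a′ * b′)) ≡ a * (a′ * (v * (b * b′)))
        regroup = solve-∀

    higman-a²≤D*b : ∀ {w Kx Ky} → I x Kx ≡ true → I w Kx ≡ true → I y Ky ≡ true → I w Ky ≡ true →
      higman-a s t * higman-a s t ≤ higman-D s t * higman-b s t
    higman-a²≤D*b {w} {Kx} {Ky} xKx wKx yKy wKy = begin
      higman-a s t * higman-a s t              ≡⟨ cong (λ a → a * a) ∑-far*traceDegree ⟨
      S₁ * S₁                                  ≤⟨ ∑-cauchy-schwarz {np} far traceDegree ⟩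
      sum far * S₂                             ≤⟨ *-mono-≤ (∑-far≤ {w} {Kx} {Ky} xKx wKx yKy wKy) ∑-far*traceDegree²≤ ⟩
      higman-D s t * higman-b s t              ∎
      where
      open ≤-Reasoning
      S₁ S₂ : ℕ
      S₁ = ∑[ z < np ] (far z * traceDegree z)
      S₂ = ∑[ z < np ] (far z * (traceDegree z * traceDegree z))

    higman-bound : t ≤ s * s
    higman-bound with ∑-pos⇒∃-pos trace (subst (0 <_) (sym ∑-trace) (s≤s z≤n))
    ... | w , w∈ with trace-lines w∈
    ... | _ , _ , xKx , wKx , yKy , wKy = higman-arithmetic s t s≥2 (higman-a²≤D*b xKx wKx yKy wKy)

  other-point-on : ∀ {a L} → I a L ≡ true → ∃[ x ] (I x L ≡ true × x ≢ a)
  other-point-on {a} {L} aL with ∑-pos⇒∃-pos _ (subst (0 <_) (sym (∑-other-points-on aL)) (<⇒≤ s≥2))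
  ... | x , x∈ with *-pos⁻ (inc x L) x∈
  ... | xL , x≢a = x , 𝟙-pos⇒≡true xL , ⟦⟧-pos⇒ (¬? (x ≟ a)) x≢a

  other-line-through : ∀ {x K} → I x K ≡ true → ∃[ L ] (I x L ≡ true × L ≢ K)
  other-line-through {x} {K} xK with ∑-pos⇒∃-pos _ (subst (0 <_) (sym (∑-other-lines-through xK)) (<⇒≤ t≥2))
  ... | L , L∈ with *-pos⁻ (inc x L) L∈
  ... | xL , L≢K = L , 𝟙-pos⇒≡true xL , ⟦⟧-pos⇒ (¬? (L ≟ K)) L≢K

  noncollinear-pair : Fin np → ∃[ x ] ∃[ z ] ¬ Collinear x z
  noncollinear-pair x =
    let (M , xM) = line-through x
        (y , yM , y≢x) = other-point-on xM
        (N , yN , N≢M) = other-line-through yM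
        (z , zN , z≢y) = other-point-on yN
    in x , z , no-triangle (y≢x ∘ sym) z≢y N≢M xM yM yN zN

  higman-inequality : Fin np → t ≤ s * s
  higman-inequality p =
    let (x , z , x≁z) = noncollinear-pair p
    in Higman.higman-bound {x} {z} x≁z

dual : Geometry → Geometry
dual Q = record { np = Geometry.nl Q ; nl = Geometry.np Q ; I = λ L x → Geometry.I Q x L }

dual-isThickGQ : ∀ {Q s t} → IsThickGQ Q s t → IsThickGQ (dual Q) t s
dual-isThickGQ {Q} {s} {t} H = record
  { atMostOneLine = at-most-one-point
  ; gqAxiomExists = exists-line
  ; gqAxiomUnique = unique-line
  ; linePoints    = pointLines
  ; pointLines    = linePoints
  ; s≥2           = t≥2
  ; t≥2           = s≥2
  }
  where
  open Geometry Q
  open IsThickGQ H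
  at-most-one-point : ∀ (L M : Fin nl) (x y : Fin np) → L ≢ M →
    I x L ≡ true → I x M ≡ true → I y L ≡ true → I y M ≡ true → x ≡ y
  at-most-one-point L M x y L≢M xL xM yL yM with x ≟ y
  ... | yes x≡y = x≡y
  ... | no  x≢y = contradiction (atMostOneLine x y L M x≢y xL yL xM yM) L≢M
  exists-line : ∀ (L : Fin nl) (x : Fin np) → I x L ≢ true →
    ∃[ M ] (I x M ≡ true × ∃[ y ] (I y L ≡ true × I y M ≡ true))
  exists-line L x x∉L with gqAxiomExists x L x∉L
  ... | y , yL , M , xM , yM = M , xM , y , yL , yM
  unique-line : ∀ (L : Fin nl) (x : Fin np) → I x L ≢ true → ∀ (M M′ : Fin nl) →
    I x M ≡ true → ∃[ y ] (I y L ≡ true × I y M ≡ true) →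
    I x M′ ≡ true → ∃[ y ] (I y L ≡ true × I y M′ ≡ true) → M ≡ M′
  unique-line L x x∉L M M′ xM (y , yL , yM) xM′ (y′ , yL′ , yM′) =
    atMostOneLine x y M M′ x≢y xM yM xM′ (subst (λ z → I z M′ ≡ true) (sym y≡y′) yM′)
    where
    y≡y′ : y ≡ y′
    y≡y′ = gqAxiomUnique x L x∉L y y′ yL (M , xM , yM) yL′ (M′ , xM′ , yM′)
    x≢y : x ≢ y
    x≢y refl = x∉L yL

lemma5p2 : (Q : Geometry) (s t : ℕ) → IsThickGQ Q s t →
    (G : AutGroup Q) → AutGroup.PointTransitive G →
    (α : Fin (Geometry.np Q)) →
      (AutGroup.order G < suc t ^ 5 * AutGroup.stabOrder G α)
      × (AutGroup.FlagTransitive G → AutGroup.order G < AutGroup.stabOrder G α ^ 6)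
lemma5p2 Q s t H G transitive α = orbit-bound , flag-bound
  where
  open Geometry Q
  open AutGroup G using (order; stabOrder)
  open GQ H using (line-through; points-bound; ∑-lines-through)
  L₀ : Fin nl
  L₀ = proj₁ (line-through α)
  s≤t² : s ≤ t * t
  s≤t² = GQ.higman-inequality (dual-isThickGQ H) L₀
  np<[1+t]⁵ : np < suc t ^ 5
  np<[1+t]⁵ = ≤-<-trans (points-bound L₀) (point-count-arithmetic s t (<⇒≤ (IsThickGQ.t≥2 H)) s≤t²)
  orbit-bound : order < suc t ^ 5 * stabOrder α
  orbit-bound = ≤-<-trans (order≤np*stabOrder G transitive α)
                          (*-monoˡ-< (stabOrder α) {{>-nonZero (stabOrder-pos G α)}} np<[1+t]⁵)
  flag-bound : AutGroup.FlagTransitive G → order < stabOrder α ^ 6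
  flag-bound flagTransitive = <-≤-trans orbit-bound (begin
    suc t ^ 5 * stabOrder α          ≤⟨ *-monoˡ-≤ (stabOrder α) (^-monoˡ-≤ 5 1+t≤stab) ⟩
    stabOrder α ^ 5 * stabOrder α    ≡⟨ *-comm (stabOrder α ^ 5) (stabOrder α) ⟩
    stabOrder α ^ 6                  ∎)
    where
    open ≤-Reasoning
    1+t≤stab : suc t ≤ stabOrder α
    1+t≤stab = subst (_≤ stabOrder α) (∑-lines-through α)
                     (lines-through≤stabOrder G flagTransitive α L₀ (proj₂ (line-through α)))
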